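{- Let $h$ be a Hessenberg function and let $0<d\le r\le n$ be integers. Then (i) $e_d(1,\ldots,r)\in I_h$ if and only if $\tilde e_d(r+1,r+2,\ldots,n)\in I_h$; and (ii) $\tilde e_d(r+1,r+2,\ldots,n)\in J_h$ if and only if $e_d(1,\ldots,r)\in J_h$.
   Context: A Hessenberg function is an $n$-tuple $h=(h_1,\ldots,h_n)$ of integers with $i\le h_i\le n$ and $h_i\le h_{i+1}$. For $S\subseteq\{1,\ldots,n\}$: $e_d(S)$ is the sum of all squarefree monomials of degree $d$ in $x_i$, $i\in S$; $\tilde e_d(S)$ is the sum of all monomials of degree $d$ in $x_i$, $i\in S$. Conventions: $e_0=\tilde e_0=1$ (also for $S=\emptyset$), both vanish for $d<0$, $e_d(S)=0$ for $d>|S|$, $\tilde e_d(\emptyset)=0$ for $d>0$; $e_d(a,\ldots,b)$ means $S=\{a,\ldots,b\}$. $I_h$ is the ideal of $\mathbb{Z}[x_1,\ldots,x_n]$ generated by $\{e_{h_i-s}(1,\ldots,h_i):1\le i\le n,\ 0\le s\le i-1\}$. The degree tuple of $h$ is $(\beta_n,\ldots,\beta_1)$ with $\beta_i=i-\#\{k:h_k<i\}$, and $J_h$ is generated by $\tilde e_{\beta_i}(i,\ldots,n)$, $i=1,\ldots,n$. -}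

module Defs where

open import Data.Nat as ℕ using (ℕ; zero; suc; _∸_; _≤_; _<_; _<?_)
open import Data.Integer as ℤ using (ℤ)
open import Data.Fin as Fin using (Fin; toℕ)
open import Data.Vec as Vec using (Vec; tabulate; zipWith; replicate)
open import Data.Vec.Properties using (≡-dec)
open import Data.List as List using (List; []; _∷_; _++_; map; concatMap; filter; length; allFin; applyUpTo; upTo)
open import Data.List.Relation.Unary.All using (All)
open import Data.List.Membership.Propositional using (_∈_)
open import Data.Product using (Σ; _×_; _,_; ∃)
open import Relation.Nullary.Decidable using (does)
open import Relation.Binary.PropositionalEquality using (_≡_)
open import Data.Bool using (if_then_else_)

-- Polynomials in ℤ[x₁,…,xₙ], represented as finite formal sums of terms
-- c·x^a (a an exponent vector). Two representations denote the same
-- polynomial iff all their coefficients agree (_≈ₚ_).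

Mon : ℕ → Set
Mon n = Vec ℕ n

Term : ℕ → Set
Term n = ℤ × Mon n

Poly : ℕ → Set
Poly n = List (Term n)

0ₚ : ∀ {n} → Poly n
0ₚ = []

1ₚ : ∀ {n} → Poly n
1ₚ = (ℤ.+ 1 , replicate _ 0) ∷ []

infixl 6 _+ₚ_
infixl 7 _*ₚ_

_+ₚ_ : ∀ {n} → Poly n → Poly n → Poly n
p +ₚ q = p ++ q

_*ₚ_ : ∀ {n} → Poly n → Poly n → Poly n
p *ₚ q = concatMap (λ { (c , a) → map (λ { (d , b) → (c ℤ.* d , zipWith ℕ._+_ a b) }) q }) p

coeff : ∀ {n} → Poly n → Mon n → ℤ
coeff [] a = ℤ.+ 0
coeff ((c , b) ∷ p) a = if does (≡-dec ℕ._≟_ b a) then c ℤ.+ coeff p a else coeff p a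

infix 4 _≈ₚ_
_≈ₚ_ : ∀ {n} → Poly n → Poly n → Set
p ≈ₚ q = ∀ a → coeff p a ≡ coeff q a

-- the variable x_i (1-based index i, 1 ≤ i ≤ n)
x : ∀ {n} → ℕ → Poly n
x i = (ℤ.+ 1 , tabulate (λ j → if does (suc (toℕ j) ℕ.≟ i) then 1 else 0)) ∷ []

lincomb : ∀ {n} → List (Poly n × Poly n) → Poly n
lincomb [] = 0ₚ
lincomb ((q , g) ∷ cs) = q *ₚ g +ₚ lincomb cs

InIdeal : ∀ {n} → List (Poly n) → Poly n → Set
InIdeal {n} G p =
  Σ (List (Poly n × Poly n)) λ cs →
    All (λ qg → Data.Product.proj₂ qg ∈ G) cs × (p ≈ₚ lincomb cs)

-- Elementary and complete homogeneous symmetric polynomials in the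
-- variables x_i, i ∈ S (S given as a duplicate-free list of 1-based indices).

e : ∀ {n} → ℕ → List ℕ → Poly n
e zero S = 1ₚ
e (suc d) [] = 0ₚ
e (suc d) (i ∷ S) = x i *ₚ e d S +ₚ e (suc d) S

ẽ : ∀ {n} → ℕ → List ℕ → Poly n
ẽ zero S = 1ₚ
ẽ (suc d) [] = 0ₚ
ẽ (suc d) (i ∷ S) = x i *ₚ ẽ d (i ∷ S) +ₚ ẽ (suc d) S

interval : ℕ → ℕ → List ℕ
interval a b = applyUpTo (a ℕ.+_) (suc b ∸ a)

-- Hessenberg functions: h (i-1) is h_i, for i = 1..n.

record IsHessenberg (n : ℕ) (h : Fin n → ℕ) : Set where
  field
    lower : ∀ i → suc (toℕ i) ≤ h i
    upper : ∀ i → h i ≤ n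
    mono  : ∀ (i : Fin n) (j : Fin n) → toℕ j ≡ suc (toℕ i) → h i ≤ h j

-- generators of I_h : e_{h_i - s}(1..h_i), 1 ≤ i ≤ n, 0 ≤ s ≤ i-1
Igens : ∀ {n} → (Fin n → ℕ) → List (Poly n)
Igens {n} h = concatMap (λ i → map (λ s → e (h i ∸ s) (interval 1 (h i))) (upTo (suc (toℕ i)))) (allFin n)

β : ∀ {n} → (Fin n → ℕ) → ℕ → ℕ
β {n} h i = i ∸ length (filter (λ k → h k <? i) (allFin n))

Jgens : ∀ {n} → (Fin n → ℕ) → List (Poly n)
Jgens {n} h = map (λ i → ẽ (β h i) (interval i n)) (interval 1 n)

module Submission where

-- Write Δ_d(A, T) = e_d(A) − (−1)^d ẽ_d(T). In any ideal containing Δ_d(A, T),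
-- e_d(A) and ẽ_d(T) are members or non-members together, because they differ by
-- Δ_d(A, T) up to a sign. Moving the first index i of T to the end of A gives
--   Δ_{d+1}(A i, T) = Δ_{d+1}(A, i T) + x_i Δ_d(A, i T),
-- so membership of all Δ_d propagates from one split of (1, …, n) to the next.
-- Since h_n = n, every e_k(1, …, n) is a generator of I_h, i.e. Δ_d(1…n, ∅) ∈ I_h,
-- and the recursion runs from r = n down to r. Since β_1 = 1 and β_{i+1} ≤ β_i + 1,
-- every ẽ_k(1, …, n) with k ≥ 1 lies in J_h, i.e. Δ_d(∅, 1…n) ∈ J_h, and the
-- recursion runs from r = 0 up to r.

open import Defs
open import Data.Nat as ℕ
  using (ℕ; zero; suc; _∸_; _≤_; _<_; s≤s; z≤n; _≤′_; ≤′-refl; ≤′-step; _≤?_; _<?_)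
import Data.Nat.Properties as ℕ
open import Data.Fin using (Fin; toℕ; fromℕ)
open import Data.Fin.Properties using (toℕ-fromℕ)
open import Data.Vec using (replicate; zipWith)
open import Data.Vec.Properties using (≡-dec; zipWith-assoc; zipWith-comm; zipWith-identityˡ)
open import Data.List using (List; []; _∷_; _++_; _∷ʳ_; map; length; filter; applyUpTo; upTo; allFin)
open import Data.List.Properties
  using (∷ʳ-++; ++-assoc; ++-identityʳ; length-filter; filter-reject; length-applyUpTo)
open import Data.List.Relation.Unary.All using ([]; _∷_)
import Data.List.Relation.Unary.All.Properties as All
open import Data.List.Membership.Propositional using (_∈_)
open import Data.List.Membership.Propositional.Properties
  using (∈-map⁺; ∈-concat⁺′; ∈-upTo⁺; ∈-applyUpTo⁺; ∈-allFin)
open import Data.List.Relation.Binary.Sublist.Propositional using (⊆-refl)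
open import Data.List.Relation.Binary.Sublist.Propositional.Properties using (filter⁺; length-mono-≤)
open import Data.List.Reverse using (Reverse; []; _∶_∶ʳ_; reverseView)
open import Data.Product using (_×_; _,_; proj₂; map₁)
open import Data.Bool using (if_then_else_)
open import Function using (_∘_)
open import Function.Bundles using (_⇔_; mk⇔)
open import Function.Construct.Symmetry using (⇔-sym)
open import Relation.Nullary using (Dec; yes; no; ¬_; ¬?; does)
open import Relation.Nullary.Negation using (contradiction)
open import Relation.Binary.PropositionalEquality

module Polynomials {n : ℕ} where

  open import Data.Integer using (ℤ; 0ℤ; 1ℤ; -1ℤ; _+_; _*_; _^_)
  open import Data.Integer.Properties
    using (+-identityˡ; +-identityʳ; +-assoc; *-assoc; *-identityˡ; *-identityʳ; *-zeroˡ; *-zeroʳ)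
  open import Data.Integer.Tactic.RingSolver using (solve-∀)

  infixl 7 _⊕_
  _⊕_ : Mon n → Mon n → Mon n
  _⊕_ = zipWith ℕ._+_

  0ᵐ : Mon n
  0ᵐ = replicate n 0

  ⊕-assoc : ∀ a b c → (a ⊕ b) ⊕ c ≡ a ⊕ (b ⊕ c)
  ⊕-assoc = zipWith-assoc ℕ.+-assoc

  ⊕-comm : ∀ a b → a ⊕ b ≡ b ⊕ a
  ⊕-comm = zipWith-comm ℕ.+-comm

  ⊕-identityˡ : ∀ a → 0ᵐ ⊕ a ≡ a
  ⊕-identityˡ = zipWith-identityˡ ℕ.+-identityˡ

  _≟ᵐ_ : (a b : Mon n) → Dec (a ≡ b)
  _≟ᵐ_ = ≡-dec ℕ._≟_

  -- lin G is the ℤ-linear map on formal sums sending the term x^m to G m. Every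
  -- coefficient is of this form (coeff≡lin-δ) and lin G is constant on ≈ₚ-classes
  -- (lin-resp-≈ₚ), which reduces all polynomial identities below to identities in ℤ.
  lin : (Mon n → ℤ) → Poly n → ℤ
  lin G [] = 0ℤ
  lin G ((c , m) ∷ p) = c * G m + lin G p

  lin-++ : ∀ G p q → lin G (p ++ q) ≡ lin G p + lin G q
  lin-++ G [] q = sym (+-identityˡ _)
  lin-++ G ((c , m) ∷ p) q = trans (cong (c * G m +_) (lin-++ G p q)) (sym (+-assoc (c * G m) _ _))

  lin-cong : ∀ {G H} → (∀ m → G m ≡ H m) → ∀ p → lin G p ≡ lin H p
  lin-cong G≗H [] = refl
  lin-cong G≗H ((c , m) ∷ p) = cong₂ _+_ (cong (c *_) (G≗H m)) (lin-cong G≗H p)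

  lin-0 : ∀ p → lin (λ _ → 0ℤ) p ≡ 0ℤ
  lin-0 [] = refl
  lin-0 ((c , m) ∷ p) rewrite lin-0 p | *-zeroʳ c = refl

  lin-+ : ∀ G H p → lin (λ m → G m + H m) p ≡ lin G p + lin H p
  lin-+ G H [] = refl
  lin-+ G H ((c , m) ∷ p) rewrite lin-+ G H p = ring c (G m) (H m) (lin G p) (lin H p)
    where
    ring : ∀ c g h x y → c * (g + h) + (x + y) ≡ (c * g + x) + (c * h + y)
    ring = solve-∀

  lin-* : ∀ s G p → lin (λ m → s * G m) p ≡ s * lin G p
  lin-* s G [] = sym (*-zeroʳ s)
  lin-* s G ((c , m) ∷ p) rewrite lin-* s G p = ring c s (G m) (lin G p)
    where
    ring : ∀ c s g x → c * (s * g) + s * x ≡ s * (c * g + x)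
    ring = solve-∀

  lin-swap : ∀ (F : Mon n → Mon n → ℤ) p q →
             lin (λ a → lin (F a) q) p ≡ lin (λ b → lin (λ a → F a b) p) q
  lin-swap F [] q = sym (lin-0 q)
  lin-swap F ((c , m) ∷ p) q = begin
    c * lin (F m) q + lin (λ a → lin (F a) q) p
      ≡⟨ cong₂ _+_ (sym (lin-* c (F m) q)) (lin-swap F p q) ⟩
    lin (λ b → c * F m b) q + lin (λ b → lin (λ a → F a b) p) q
      ≡⟨ lin-+ _ _ q ⟨
    lin (λ b → c * F m b + lin (λ a → F a b) p) q ∎
    where open ≡-Reasoning

  scale : ℤ → Poly n → Poly n
  scale s = map (map₁ (s *_))

  lin-scale : ∀ s G p → lin G (scale s p) ≡ s * lin G p
  lin-scale s G [] = sym (*-zeroʳ s)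
  lin-scale s G ((c , m) ∷ p) rewrite lin-scale s G p = ring s c (G m) (lin G p)
    where
    ring : ∀ s c g x → s * c * g + s * x ≡ s * (c * g + x)
    ring = solve-∀

  -- stated for every f that acts like the pattern lambda inside _*ₚ_, which cannot be named here
  lin-map-shift : ∀ G (f : Term n → Term n) c a → (∀ d b → f (d , b) ≡ (c * d , a ⊕ b)) →
                  ∀ q → lin G (map f q) ≡ c * lin (λ b → G (a ⊕ b)) q
  lin-map-shift G f c a f-shifts [] = sym (*-zeroʳ c)
  lin-map-shift G f c a f-shifts ((d , b) ∷ q)
    rewrite f-shifts d b | lin-map-shift G f c a f-shifts q = ring c d (G (a ⊕ b)) _
    where
    ring : ∀ c d g x → c * d * g + c * x ≡ c * (d * g + x)
    ring = solve-∀

  lin-*ₚ : ∀ G p q → lin G (p *ₚ q) ≡ lin (λ a → lin (λ b → G (a ⊕ b)) q) p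
  lin-*ₚ G [] q = refl
  lin-*ₚ G ((c , a) ∷ p) q =
    trans (lin-++ G (map _ q) (p *ₚ q))
          (cong₂ _+_ (lin-map-shift G _ c a (λ _ _ → refl) q) (lin-*ₚ G p q))

  δ : Mon n → Mon n → ℤ
  δ a b = if does (b ≟ᵐ a) then 1ℤ else 0ℤ

  coeff≡lin-δ : ∀ p a → coeff p a ≡ lin (δ a) p
  coeff≡lin-δ [] a = refl
  coeff≡lin-δ ((c , b) ∷ p) a with b ≟ᵐ a
  ... | yes _ = cong₂ _+_ (sym (*-identityʳ c)) (coeff≡lin-δ p a)
  ... | no _ = trans (coeff≡lin-δ p a) (sym (trans (cong (_+ lin (δ a) p) (*-zeroʳ c)) (+-identityˡ _)))

  other-than : (m : Mon n) (t : Term n) → Dec (¬ proj₂ t ≡ m)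
  other-than m t = ¬? (proj₂ t ≟ᵐ m)

  without : Mon n → Poly n → Poly n
  without m = filter (other-than m)

  lin-split : ∀ G m p → lin G p ≡ coeff p m * G m + lin G (without m p)
  lin-split G m [] = refl
  lin-split G m ((c , b) ∷ p) with b ≟ᵐ m
  ... | yes refl rewrite lin-split G b p = ring c (G b) (coeff p b) (lin G (without b p))
    where
    ring : ∀ c g k x → c * g + (k * g + x) ≡ (c + k) * g + x
    ring = solve-∀
  ... | no _ rewrite lin-split G m p = ring c (G b) (G m) (coeff p m) (lin G (without m p))
    where
    ring : ∀ c g h k x → c * g + (k * h + x) ≡ k * h + (c * g + x)
    ring = solve-∀

  coeff-without-≡ : ∀ m p → coeff (without m p) m ≡ 0ℤ
  coeff-without-≡ m [] = refl
  coeff-without-≡ m ((c , b) ∷ p) with b ≟ᵐ m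
  ... | yes _ = coeff-without-≡ m p
  ... | no b≢m with b ≟ᵐ m
  ...   | yes b≡m = contradiction b≡m b≢m
  ...   | no _ = coeff-without-≡ m p

  coeff-without-≢ : ∀ m a p → m ≢ a → coeff (without m p) a ≡ coeff p a
  coeff-without-≢ m a [] m≢a = refl
  coeff-without-≢ m a ((c , b) ∷ p) m≢a with b ≟ᵐ m
  ... | yes refl with b ≟ᵐ a
  ...   | yes b≡a = contradiction b≡a m≢a
  ...   | no _ = coeff-without-≢ m a p m≢a
  coeff-without-≢ m a ((c , b) ∷ p) m≢a | no _ with b ≟ᵐ a
  ...   | yes _ = cong (c +_) (coeff-without-≢ m a p m≢a)
  ...   | no _ = coeff-without-≢ m a p m≢a

  coeffs≡0⇒lin≡0 : ∀ G p → (∀ a → coeff p a ≡ 0ℤ) → lin G p ≡ 0ℤ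
  coeffs≡0⇒lin≡0 G p = go (length p) p ℕ.≤-refl
    where
    go : ∀ k p → length p ≤ k → (∀ a → coeff p a ≡ 0ℤ) → lin G p ≡ 0ℤ
    go _ [] _ _ = refl
    go (suc k) p@((c , m) ∷ p′) (s≤s |p′|≤k) p≈0 = begin
      lin G p                                ≡⟨ lin-split G m p ⟩
      coeff p m * G m + lin G (without m p)  ≡⟨ cong₂ _+_ (cong (_* G m) (p≈0 m)) rest≡0 ⟩
      0ℤ * G m + 0ℤ                          ≡⟨ +-identityʳ _ ⟩
      0ℤ * G m                               ≡⟨ *-zeroˡ (G m) ⟩
      0ℤ                                     ∎
      where
      open ≡-Reasoning
      shorter : length (without m p) ≤ k
      shorter = ℕ.≤-trans (ℕ.≤-reflexive (cong length (filter-reject (other-than m) (λ m≢m → m≢m refl))))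
                          (ℕ.≤-trans (length-filter (other-than m) p′) |p′|≤k)
      rest≈0 : ∀ a → coeff (without m p) a ≡ 0ℤ
      rest≈0 a with m ≟ᵐ a
      ... | yes refl = coeff-without-≡ m p
      ... | no m≢a = trans (coeff-without-≢ m a p m≢a) (p≈0 a)
      rest≡0 : lin G (without m p) ≡ 0ℤ
      rest≡0 = go k (without m p) shorter rest≈0

  lin-resp-≈ₚ : ∀ G {p q} → p ≈ₚ q → lin G p ≡ lin G q
  lin-resp-≈ₚ G {p} {q} p≈q = begin
    lin G p                                ≡⟨ ring (lin G p) (lin G q) ⟩
    (lin G p + -1ℤ * lin G q) + lin G q    ≡⟨ cong (_+ lin G q) difference≡0 ⟩
    0ℤ + lin G q                           ≡⟨ +-identityˡ _ ⟩
    lin G q                                ∎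
    where
    open ≡-Reasoning
    ring : ∀ x y → x ≡ (x + -1ℤ * y) + y
    ring = solve-∀
    cancel : ∀ x → x + -1ℤ * x ≡ 0ℤ
    cancel = solve-∀
    r = p ++ scale -1ℤ q
    lin-r : ∀ G → lin G r ≡ lin G p + -1ℤ * lin G q
    lin-r G = trans (lin-++ G p _) (cong (lin G p +_) (lin-scale -1ℤ G q))
    r≈0 : ∀ a → coeff r a ≡ 0ℤ
    r≈0 a = begin
      coeff r a
        ≡⟨ trans (coeff≡lin-δ r a) (lin-r (δ a)) ⟩
      lin (δ a) p + -1ℤ * lin (δ a) q
        ≡⟨ cong₂ (λ u v → u + -1ℤ * v) (coeff≡lin-δ p a) (coeff≡lin-δ q a) ⟨
      coeff p a + -1ℤ * coeff q a
        ≡⟨ cong (λ v → coeff p a + -1ℤ * v) (p≈q a) ⟨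
      coeff p a + -1ℤ * coeff p a
        ≡⟨ cancel (coeff p a) ⟩
      0ℤ ∎
    difference≡0 : lin G p + -1ℤ * lin G q ≡ 0ℤ
    difference≡0 = trans (sym (lin-r G)) (coeffs≡0⇒lin≡0 G r r≈0)

  ≈ₚ-refl : ∀ {p : Poly n} → p ≈ₚ p
  ≈ₚ-refl a = refl

  ≈ₚ-sym : ∀ {p q : Poly n} → p ≈ₚ q → q ≈ₚ p
  ≈ₚ-sym p≈q a = sym (p≈q a)

  ≈ₚ-trans : ∀ {p q r : Poly n} → p ≈ₚ q → q ≈ₚ r → p ≈ₚ r
  ≈ₚ-trans p≈q q≈r a = trans (p≈q a) (q≈r a)

  coeff-+ₚ : ∀ p q a → coeff (p +ₚ q) a ≡ coeff p a + coeff q a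
  coeff-+ₚ p q a rewrite coeff≡lin-δ (p +ₚ q) a | coeff≡lin-δ p a | coeff≡lin-δ q a = lin-++ (δ a) p q

  coeff-scale : ∀ s p a → coeff (scale s p) a ≡ s * coeff p a
  coeff-scale s p a rewrite coeff≡lin-δ (scale s p) a | coeff≡lin-δ p a = lin-scale s (δ a) p

  coeff-+ₚ-scale : ∀ p s q a → coeff (p +ₚ scale s q) a ≡ coeff p a + s * coeff q a
  coeff-+ₚ-scale p s q a = trans (coeff-+ₚ p (scale s q) a) (cong (coeff p a +_) (coeff-scale s q a))

  coeff-*ₚ : ∀ p q a → coeff (p *ₚ q) a ≡ lin (λ m → lin (λ b → δ a (m ⊕ b)) q) p
  coeff-*ₚ p q a = trans (coeff≡lin-δ (p *ₚ q) a) (lin-*ₚ (δ a) p q)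

  *ₚ-congˡ : ∀ q {p p′} → p ≈ₚ p′ → q *ₚ p ≈ₚ q *ₚ p′
  *ₚ-congˡ q {p} {p′} p≈p′ a = begin
    coeff (q *ₚ p) a
      ≡⟨ coeff-*ₚ q p a ⟩
    lin (λ m → lin (δ-shift m) p) q
      ≡⟨ lin-cong (λ m → lin-resp-≈ₚ (δ-shift m) {p} {p′} p≈p′) q ⟩
    lin (λ m → lin (δ-shift m) p′) q
      ≡⟨ coeff-*ₚ q p′ a ⟨
    coeff (q *ₚ p′) a ∎
    where
    open ≡-Reasoning
    δ-shift : Mon n → Mon n → ℤ
    δ-shift m b = δ a (m ⊕ b)

  *ₚ-distribˡ-+ₚ : ∀ p q r → p *ₚ (q +ₚ r) ≈ₚ p *ₚ q +ₚ p *ₚ r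
  *ₚ-distribˡ-+ₚ p q r a = begin
    coeff (p *ₚ (q +ₚ r)) a                                  ≡⟨ coeff-*ₚ p (q +ₚ r) a ⟩
    lin (λ m → lin (δ-shift m) (q +ₚ r)) p                   ≡⟨ lin-cong (λ m → lin-++ (δ-shift m) q r) p ⟩
    lin (λ m → lin (δ-shift m) q + lin (δ-shift m) r) p      ≡⟨ lin-+ _ _ p ⟩
    lin (λ m → lin (δ-shift m) q) p + lin (λ m → lin (δ-shift m) r) p
                                                   ≡⟨ cong₂ _+_ (coeff-*ₚ p q a) (coeff-*ₚ p r a) ⟨
    coeff (p *ₚ q) a + coeff (p *ₚ r) a                      ≡⟨ coeff-+ₚ (p *ₚ q) (p *ₚ r) a ⟨
    coeff (p *ₚ q +ₚ p *ₚ r) a                               ∎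
    where
    open ≡-Reasoning
    δ-shift : Mon n → Mon n → ℤ
    δ-shift m b = δ a (m ⊕ b)

  *ₚ-scale : ∀ s p q → p *ₚ scale s q ≈ₚ scale s (p *ₚ q)
  *ₚ-scale s p q a = begin
    coeff (p *ₚ scale s q) a                       ≡⟨ coeff-*ₚ p (scale s q) a ⟩
    lin (λ m → lin (δ-shift m) (scale s q)) p      ≡⟨ lin-cong (λ m → lin-scale s (δ-shift m) q) p ⟩
    lin (λ m → s * lin (δ-shift m) q) p            ≡⟨ lin-* s _ p ⟩
    s * lin (λ m → lin (δ-shift m) q) p            ≡⟨ cong (s *_) (coeff-*ₚ p q a) ⟨
    s * coeff (p *ₚ q) a                           ≡⟨ coeff-scale s (p *ₚ q) a ⟨
    coeff (scale s (p *ₚ q)) a                     ∎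
    where
    open ≡-Reasoning
    δ-shift : Mon n → Mon n → ℤ
    δ-shift m b = δ a (m ⊕ b)

  triple : Mon n → Poly n → Poly n → Poly n → (Mon n → Mon n → Mon n → Mon n) → ℤ
  triple a p q r _·_·_ = lin (λ m → lin (λ m′ → lin (λ b → δ a (m · m′ · b)) r) q) p

  coeff-*ₚ-*ₚ : ∀ p q r a → coeff (p *ₚ (q *ₚ r)) a ≡ triple a p q r (λ m m′ b → m ⊕ (m′ ⊕ b))
  coeff-*ₚ-*ₚ p q r a = trans (coeff-*ₚ p (q *ₚ r) a) (lin-cong (λ m → lin-*ₚ _ q r) p)

  *ₚ-assoc : ∀ p q r → p *ₚ (q *ₚ r) ≈ₚ (p *ₚ q) *ₚ r
  *ₚ-assoc p q r a = begin
    coeff (p *ₚ (q *ₚ r)) a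
      ≡⟨ coeff-*ₚ-*ₚ p q r a ⟩
    triple a p q r (λ m m′ b → m ⊕ (m′ ⊕ b))
      ≡⟨ lin-cong (λ m → lin-cong (λ m′ → lin-cong (λ b → cong (δ a) (⊕-assoc m m′ b)) r) q) p ⟨
    triple a p q r (λ m m′ b → (m ⊕ m′) ⊕ b)
      ≡⟨ lin-*ₚ _ p q ⟨
    lin (λ m → lin (λ b → δ a (m ⊕ b)) r) (p *ₚ q)
      ≡⟨ coeff-*ₚ (p *ₚ q) r a ⟨
    coeff ((p *ₚ q) *ₚ r) a ∎
    where open ≡-Reasoning

  *ₚ-left-comm : ∀ p q r → p *ₚ (q *ₚ r) ≈ₚ q *ₚ (p *ₚ r)
  *ₚ-left-comm p q r a = begin
    coeff (p *ₚ (q *ₚ r)) a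
      ≡⟨ coeff-*ₚ-*ₚ p q r a ⟩
    triple a p q r (λ m m′ b → m ⊕ (m′ ⊕ b))
      ≡⟨ lin-swap _ p q ⟩
    triple a q p r (λ m′ m b → m ⊕ (m′ ⊕ b))
      ≡⟨ lin-cong (λ m′ → lin-cong (λ m → lin-cong (λ b → cong (δ a) (⊕-left-comm m m′ b)) r) p) q ⟩
    triple a q p r (λ m′ m b → m′ ⊕ (m ⊕ b))
      ≡⟨ coeff-*ₚ-*ₚ q p r a ⟨
    coeff (q *ₚ (p *ₚ r)) a ∎
    where
    open ≡-Reasoning
    ⊕-left-comm : ∀ m m′ b → m ⊕ (m′ ⊕ b) ≡ m′ ⊕ (m ⊕ b)
    ⊕-left-comm m m′ b =
      trans (sym (⊕-assoc m m′ b)) (trans (cong (_⊕ b) (⊕-comm m m′)) (⊕-assoc m′ m b))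

  *ₚ-zeroʳ : ∀ p → p *ₚ 0ₚ ≈ₚ 0ₚ
  *ₚ-zeroʳ p a = trans (coeff-*ₚ p 0ₚ a) (lin-0 p)

  constant : ℤ → Poly n
  constant s = (s , 0ᵐ) ∷ []

  constant-*ₚ : ∀ s p → constant s *ₚ p ≈ₚ scale s p
  constant-*ₚ s p a = begin
    coeff (constant s *ₚ p) a                ≡⟨ coeff-*ₚ (constant s) p a ⟩
    s * lin (λ b → δ a (0ᵐ ⊕ b)) p + 0ℤ      ≡⟨ +-identityʳ _ ⟩
    s * lin (λ b → δ a (0ᵐ ⊕ b)) p           ≡⟨ cong (s *_) (lin-cong (cong (δ a) ∘ ⊕-identityˡ) p) ⟩
    s * lin (δ a) p                          ≡⟨ cong (s *_) (coeff≡lin-δ p a) ⟨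
    s * coeff p a                            ≡⟨ coeff-scale s p a ⟨
    coeff (scale s p) a                      ∎
    where open ≡-Reasoning

  lincomb-++ : ∀ cs ds → lincomb {n} (cs ++ ds) ≡ lincomb cs +ₚ lincomb ds
  lincomb-++ [] ds = refl
  lincomb-++ ((q , g) ∷ cs) ds = trans (cong (q *ₚ g +ₚ_) (lincomb-++ cs ds)) (sym (++-assoc (q *ₚ g) _ _))

  *ₚ-lincomb : ∀ q cs → q *ₚ lincomb cs ≈ₚ lincomb (map (map₁ (q *ₚ_)) cs)
  *ₚ-lincomb q [] = *ₚ-zeroʳ q
  *ₚ-lincomb q ((r , g) ∷ cs) a = begin
    ⟦ q *ₚ (r *ₚ g +ₚ lincomb cs) ⟧              ≡⟨ *ₚ-distribˡ-+ₚ q (r *ₚ g) (lincomb cs) a ⟩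
    ⟦ q *ₚ (r *ₚ g) +ₚ q *ₚ lincomb cs ⟧         ≡⟨ coeff-+ₚ (q *ₚ (r *ₚ g)) _ a ⟩
    ⟦ q *ₚ (r *ₚ g) ⟧ + ⟦ q *ₚ lincomb cs ⟧      ≡⟨ cong₂ _+_ (*ₚ-assoc q r g a) (*ₚ-lincomb q cs a) ⟩
    ⟦ (q *ₚ r) *ₚ g ⟧ + ⟦ lincomb q·cs ⟧         ≡⟨ coeff-+ₚ ((q *ₚ r) *ₚ g) _ a ⟨
    ⟦ (q *ₚ r) *ₚ g +ₚ lincomb q·cs ⟧            ∎
    where
    open ≡-Reasoning
    ⟦_⟧ : Poly n → ℤ
    ⟦ p ⟧ = coeff p a
    q·cs = map (map₁ (q *ₚ_)) cs

  module _ (gens : List (Poly n)) where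

    InIdeal-resp : ∀ p q → p ≈ₚ q → InIdeal gens q → InIdeal gens p
    InIdeal-resp p q p≈q (cs , cs∈gens , q≈cs) = cs , cs∈gens , ≈ₚ-trans {p} {q} {lincomb cs} p≈q q≈cs

    InIdeal-0ₚ : InIdeal gens 0ₚ
    InIdeal-0ₚ = [] , [] , ≈ₚ-refl {0ₚ}

    InIdeal-gen : ∀ {g} → g ∈ gens → InIdeal gens g
    InIdeal-gen {g} g∈gens = (1ₚ , g) ∷ [] , g∈gens ∷ [] , λ a → sym (begin
      coeff (1ₚ *ₚ g +ₚ 0ₚ) a     ≡⟨ coeff-+ₚ (1ₚ *ₚ g) 0ₚ a ⟩
      coeff (1ₚ *ₚ g) a + 0ℤ      ≡⟨ +-identityʳ _ ⟩
      coeff (1ₚ *ₚ g) a           ≡⟨ constant-*ₚ 1ℤ g a ⟩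
      coeff (scale 1ℤ g) a        ≡⟨ coeff-scale 1ℤ g a ⟩
      1ℤ * coeff g a              ≡⟨ *-identityˡ _ ⟩
      coeff g a                   ∎)
      where open ≡-Reasoning

    InIdeal-+ₚ : ∀ p q → InIdeal gens p → InIdeal gens q → InIdeal gens (p +ₚ q)
    InIdeal-+ₚ p q (cs , cs∈gens , p≈cs) (ds , ds∈gens , q≈ds) =
      cs ++ ds , All.++⁺ cs∈gens ds∈gens , λ a → begin
        coeff (p +ₚ q) a                              ≡⟨ coeff-+ₚ p q a ⟩
        coeff p a + coeff q a                         ≡⟨ cong₂ _+_ (p≈cs a) (q≈ds a) ⟩
        coeff (lincomb cs) a + coeff (lincomb ds) a   ≡⟨ coeff-+ₚ (lincomb cs) (lincomb ds) a ⟨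
        coeff (lincomb cs +ₚ lincomb ds) a            ≡⟨ cong (λ r → coeff r a) (lincomb-++ cs ds) ⟨
        coeff (lincomb (cs ++ ds)) a                  ∎
      where open ≡-Reasoning

    InIdeal-*ₚ : ∀ q p → InIdeal gens p → InIdeal gens (q *ₚ p)
    InIdeal-*ₚ q p (cs , cs∈gens , p≈cs) =
      map (map₁ (q *ₚ_)) cs , All.map⁺ cs∈gens ,
      ≈ₚ-trans {q *ₚ p} {q *ₚ lincomb cs} {lincomb (map (map₁ (q *ₚ_)) cs)}
               (*ₚ-congˡ q {p} p≈cs) (*ₚ-lincomb q cs)

    InIdeal-scale : ∀ s p → InIdeal gens p → InIdeal gens (scale s p)
    InIdeal-scale s p p∈ =
      InIdeal-resp (scale s p) (constant s *ₚ p) (≈ₚ-sym {constant s *ₚ p} {scale s p} (constant-*ₚ s p))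
        (InIdeal-*ₚ (constant s) p p∈)

    InIdeal-cancelʳ : ∀ p q → InIdeal gens (p +ₚ q) → InIdeal gens q → InIdeal gens p
    InIdeal-cancelʳ p q p+q∈ q∈ =
      InIdeal-resp p ((p +ₚ q) +ₚ scale -1ℤ q) p≈
        (InIdeal-+ₚ (p +ₚ q) (scale -1ℤ q) p+q∈ (InIdeal-scale -1ℤ q q∈))
      where
      ring : ∀ x y → x ≡ (x + y) + -1ℤ * y
      ring = solve-∀
      p≈ : p ≈ₚ (p +ₚ q) +ₚ scale -1ℤ q
      p≈ a = trans (ring (coeff p a) (coeff q a))
        (sym (trans (coeff-+ₚ-scale (p +ₚ q) -1ℤ q a) (cong (_+ -1ℤ * coeff q a) (coeff-+ₚ p q a))))

    InIdeal-cancelˡ : ∀ p q → InIdeal gens (p +ₚ q) → InIdeal gens p → InIdeal gens q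
    InIdeal-cancelˡ p q p+q∈ p∈ =
      InIdeal-resp q ((p +ₚ q) +ₚ scale -1ℤ p) q≈
        (InIdeal-+ₚ (p +ₚ q) (scale -1ℤ p) p+q∈ (InIdeal-scale -1ℤ p p∈))
      where
      ring : ∀ x y → y ≡ (x + y) + -1ℤ * x
      ring = solve-∀
      q≈ : q ≈ₚ (p +ₚ q) +ₚ scale -1ℤ p
      q≈ a = trans (ring (coeff p a) (coeff q a))
        (sym (trans (coeff-+ₚ-scale (p +ₚ q) -1ℤ p a) (cong (_+ -1ℤ * coeff p a) (coeff-+ₚ p q a))))

  e-∷ʳ : ∀ S i d → e (suc d) (S ∷ʳ i) ≈ₚ e (suc d) S +ₚ x i *ₚ e d S
  e-∷ʳ [] i d a = cong (λ r → coeff r a) (++-identityʳ (x i *ₚ e d []))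
  e-∷ʳ (j ∷ S) i zero a = begin
    ⟦ x j *ₚ 1ₚ +ₚ e 1 (S ∷ʳ i) ⟧
      ≡⟨ coeff-+ₚ (x j *ₚ 1ₚ) (e 1 (S ∷ʳ i)) a ⟩
    ⟦ x j *ₚ 1ₚ ⟧ + ⟦ e 1 (S ∷ʳ i) ⟧
      ≡⟨ cong (⟦ x j *ₚ 1ₚ ⟧ +_) (e-∷ʳ S i zero a) ⟩
    ⟦ x j *ₚ 1ₚ ⟧ + ⟦ e 1 S +ₚ x i *ₚ 1ₚ ⟧
      ≡⟨ coeff-+ₚ (x j *ₚ 1ₚ) (e 1 S +ₚ x i *ₚ 1ₚ) a ⟨
    ⟦ x j *ₚ 1ₚ +ₚ (e 1 S +ₚ x i *ₚ 1ₚ) ⟧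
      ≡⟨ cong ⟦_⟧ (++-assoc (x j *ₚ 1ₚ) (e 1 S) _) ⟨
    ⟦ (x j *ₚ 1ₚ +ₚ e 1 S) +ₚ x i *ₚ 1ₚ ⟧ ∎
    where
    open ≡-Reasoning
    ⟦_⟧ : Poly n → ℤ
    ⟦ p ⟧ = coeff p a
  e-∷ʳ (j ∷ S) i (suc d) a = begin
    ⟦ x j *ₚ e (suc d) (S ∷ʳ i) +ₚ e (suc (suc d)) (S ∷ʳ i) ⟧
      ≡⟨ coeff-+ₚ (x j *ₚ e (suc d) (S ∷ʳ i)) _ a ⟩
    ⟦ x j *ₚ e (suc d) (S ∷ʳ i) ⟧ + ⟦ e (suc (suc d)) (S ∷ʳ i) ⟧
      ≡⟨ cong₂ _+_ (*ₚ-congˡ (x j) {e (suc d) (S ∷ʳ i)} {E₁ +ₚ x i *ₚ E₀} (e-∷ʳ S i d) a)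
                   (e-∷ʳ S i (suc d) a) ⟩
    ⟦ x j *ₚ (E₁ +ₚ x i *ₚ E₀) ⟧ + ⟦ E₂ +ₚ x i *ₚ E₁ ⟧
      ≡⟨ cong₂ _+_ (trans (*ₚ-distribˡ-+ₚ (x j) E₁ _ a) (coeff-+ₚ (x j *ₚ E₁) _ a))
                   (coeff-+ₚ E₂ _ a) ⟩
    (⟦ x j *ₚ E₁ ⟧ + ⟦ x j *ₚ (x i *ₚ E₀) ⟧) + (⟦ E₂ ⟧ + ⟦ x i *ₚ E₁ ⟧)
      ≡⟨ cong (λ v → (⟦ x j *ₚ E₁ ⟧ + v) + (⟦ E₂ ⟧ + ⟦ x i *ₚ E₁ ⟧))
              (*ₚ-left-comm (x j) (x i) E₀ a) ⟩
    (⟦ x j *ₚ E₁ ⟧ + ⟦ x i *ₚ (x j *ₚ E₀) ⟧) + (⟦ E₂ ⟧ + ⟦ x i *ₚ E₁ ⟧)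
      ≡⟨ ring ⟦ x j *ₚ E₁ ⟧ ⟦ x i *ₚ (x j *ₚ E₀) ⟧ ⟦ E₂ ⟧ ⟦ x i *ₚ E₁ ⟧ ⟩
    (⟦ x j *ₚ E₁ ⟧ + ⟦ E₂ ⟧) + (⟦ x i *ₚ (x j *ₚ E₀) ⟧ + ⟦ x i *ₚ E₁ ⟧)
      ≡⟨ cong₂ _+_ (coeff-+ₚ (x j *ₚ E₁) E₂ a)
                   (trans (*ₚ-distribˡ-+ₚ (x i) (x j *ₚ E₀) E₁ a)
                          (coeff-+ₚ (x i *ₚ (x j *ₚ E₀)) (x i *ₚ E₁) a)) ⟨
    ⟦ x j *ₚ E₁ +ₚ E₂ ⟧ + ⟦ x i *ₚ (x j *ₚ E₀ +ₚ E₁) ⟧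
      ≡⟨ coeff-+ₚ (x j *ₚ E₁ +ₚ E₂) _ a ⟨
    ⟦ (x j *ₚ E₁ +ₚ E₂) +ₚ x i *ₚ (x j *ₚ E₀ +ₚ E₁) ⟧ ∎
    where
    open ≡-Reasoning
    ⟦_⟧ : Poly n → ℤ
    ⟦ p ⟧ = coeff p a
    E₀ = e d S
    E₁ = e (suc d) S
    E₂ = e (suc (suc d)) S
    ring : ∀ p q r t → (p + q) + (r + t) ≡ (p + r) + (q + t)
    ring = solve-∀

  sign : ℕ → ℤ
  sign d = -1ℤ ^ d

  sign-square : ∀ d → sign d * sign d ≡ 1ℤ
  sign-square zero = refl
  sign-square (suc d) = trans (ring (sign d)) (sign-square d)
    where
    ring : ∀ s → (-1ℤ * s) * (-1ℤ * s) ≡ s * s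
    ring = solve-∀

  scale-sign-involutive : ∀ d p → scale (sign d) (scale (sign d) p) ≈ₚ p
  scale-sign-involutive d p a = begin
    coeff (scale s (scale s p)) a    ≡⟨ trans (coeff-scale s (scale s p) a) (cong (s *_) (coeff-scale s p a)) ⟩
    s * (s * coeff p a)              ≡⟨ *-assoc s s _ ⟨
    s * s * coeff p a                ≡⟨ cong (_* coeff p a) (sign-square d) ⟩
    1ℤ * coeff p a                   ≡⟨ *-identityˡ _ ⟩
    coeff p a                        ∎
    where
    open ≡-Reasoning
    s = sign d

  Δ : List ℕ → List ℕ → ℕ → Poly n
  Δ A T d = e d A +ₚ scale (sign (suc d)) (ẽ d T)

  Δ-0 : ∀ A T → Δ A T 0 ≈ₚ 0ₚ
  Δ-0 A T a = trans (coeff-+ₚ-scale 1ₚ -1ℤ 1ₚ a) (cancel (coeff {n} 1ₚ a))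
    where
    cancel : ∀ c → c + -1ℤ * c ≡ 0ℤ
    cancel = solve-∀

  Δ-∷ʳ : ∀ A i T d → Δ (A ∷ʳ i) T (suc d) ≈ₚ Δ A (i ∷ T) (suc d) +ₚ x i *ₚ Δ A (i ∷ T) d
  Δ-∷ʳ A i T d a = begin
    ⟦ Δ (A ∷ʳ i) T (suc d) ⟧
      ≡⟨ coeff-+ₚ-scale (e (suc d) (A ∷ʳ i)) s₂ (ẽ (suc d) T) a ⟩
    ⟦ e (suc d) (A ∷ʳ i) ⟧ + s₂ * H
      ≡⟨ cong (_+ s₂ * H) e-split ⟩
    (E + X) + s₂ * H
      ≡⟨ ring s₁ E X Y H ⟩
    (E + s₂ * (Y + H)) + (X + s₁ * Y)
      ≡⟨ cong₂ _+_ Δ-suc xΔ ⟨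
    ⟦ Δ A (i ∷ T) (suc d) ⟧ + ⟦ x i *ₚ Δ A (i ∷ T) d ⟧
      ≡⟨ coeff-+ₚ (Δ A (i ∷ T) (suc d)) _ a ⟨
    ⟦ Δ A (i ∷ T) (suc d) +ₚ x i *ₚ Δ A (i ∷ T) d ⟧ ∎
    where
    open ≡-Reasoning
    ⟦_⟧ : Poly n → ℤ
    ⟦ p ⟧ = coeff p a
    s₁ = sign (suc d)
    s₂ = sign (suc (suc d))
    E = ⟦ e (suc d) A ⟧
    X = ⟦ x i *ₚ e d A ⟧
    Ẽ = ẽ d (i ∷ T)
    Y = ⟦ x i *ₚ Ẽ ⟧
    H = ⟦ ẽ (suc d) T ⟧
    ring : ∀ s e x y h → (e + x) + (-1ℤ * s) * h ≡ (e + (-1ℤ * s) * (y + h)) + (x + s * y)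
    ring = solve-∀
    e-split : ⟦ e (suc d) (A ∷ʳ i) ⟧ ≡ E + X
    e-split = trans (e-∷ʳ A i d a) (coeff-+ₚ (e (suc d) A) (x i *ₚ e d A) a)
    Δ-suc : ⟦ Δ A (i ∷ T) (suc d) ⟧ ≡ E + s₂ * (Y + H)
    Δ-suc = trans (coeff-+ₚ-scale (e (suc d) A) s₂ (ẽ (suc d) (i ∷ T)) a)
                  (cong (λ v → E + s₂ * v) (coeff-+ₚ (x i *ₚ ẽ d (i ∷ T)) (ẽ (suc d) T) a))
    xΔ : ⟦ x i *ₚ Δ A (i ∷ T) d ⟧ ≡ X + s₁ * Y
    xΔ = begin
      ⟦ x i *ₚ Δ A (i ∷ T) d ⟧                            ≡⟨ *ₚ-distribˡ-+ₚ (x i) (e d A) _ a ⟩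
      ⟦ x i *ₚ e d A +ₚ x i *ₚ scale s₁ Ẽ ⟧               ≡⟨ coeff-+ₚ (x i *ₚ e d A) _ a ⟩
      X + ⟦ x i *ₚ scale s₁ Ẽ ⟧                           ≡⟨ cong (X +_) (*ₚ-scale s₁ (x i) Ẽ a) ⟩
      X + ⟦ scale s₁ (x i *ₚ Ẽ) ⟧                         ≡⟨ cong (X +_) (coeff-scale s₁ (x i *ₚ Ẽ) a) ⟩
      X + s₁ * Y                                          ∎

  module _ (gens : List (Poly n)) where

    Δ∈⇒[e∈⇔ẽ∈] : ∀ A T d → InIdeal gens (Δ A T d) → InIdeal gens (e d A) ⇔ InIdeal gens (ẽ d T)
    Δ∈⇒[e∈⇔ẽ∈] A T d Δ∈ = mk⇔ e∈⇒ẽ∈ ẽ∈⇒e∈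
      where
      s = sign (suc d)
      e∈⇒ẽ∈ : InIdeal gens (e d A) → InIdeal gens (ẽ d T)
      e∈⇒ẽ∈ e∈ =
        InIdeal-resp gens (ẽ d T) (scale s (scale s (ẽ d T)))
          (≈ₚ-sym {scale s (scale s (ẽ d T))} {ẽ d T} (scale-sign-involutive (suc d) (ẽ d T)))
          (InIdeal-scale gens s (scale s (ẽ d T)) (InIdeal-cancelˡ gens (e d A) (scale s (ẽ d T)) Δ∈ e∈))
      ẽ∈⇒e∈ : InIdeal gens (ẽ d T) → InIdeal gens (e d A)
      ẽ∈⇒e∈ ẽ∈ =
        InIdeal-cancelʳ gens (e d A) (scale s (ẽ d T)) Δ∈ (InIdeal-scale gens s (ẽ d T) ẽ∈)

    Δ-0∈ : ∀ A T → InIdeal gens (Δ A T 0)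
    Δ-0∈ A T = InIdeal-resp gens (Δ A T 0) 0ₚ (Δ-0 A T) (InIdeal-0ₚ gens)

    e∈⇒Δ∈ : ∀ A T → (∀ k → InIdeal gens (e (suc k) (A ++ T))) → ∀ d → InIdeal gens (Δ A T d)
    e∈⇒Δ∈ A T e∈ zero = Δ-0∈ A T
    e∈⇒Δ∈ A [] e∈ (suc d) =
      InIdeal-+ₚ gens (e (suc d) A) 0ₚ
        (subst (InIdeal gens ∘ e (suc d)) (++-identityʳ A) (e∈ d)) (InIdeal-0ₚ gens)
    e∈⇒Δ∈ A (i ∷ T) e∈ (suc d) =
      InIdeal-cancelʳ gens (Δ A (i ∷ T) (suc d)) (x i *ₚ Δ A (i ∷ T) d)
        (InIdeal-resp gens (Δ A (i ∷ T) (suc d) +ₚ x i *ₚ Δ A (i ∷ T) d) (Δ (A ∷ʳ i) T (suc d))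
          (≈ₚ-sym {Δ (A ∷ʳ i) T (suc d)} {Δ A (i ∷ T) (suc d) +ₚ x i *ₚ Δ A (i ∷ T) d} (Δ-∷ʳ A i T d))
          (e∈⇒Δ∈ (A ∷ʳ i) T e∈′ (suc d)))
        (InIdeal-*ₚ gens (x i) (Δ A (i ∷ T) d) (e∈⇒Δ∈ A (i ∷ T) e∈ d))
      where
      e∈′ : ∀ k → InIdeal gens (e (suc k) (A ∷ʳ i ++ T))
      e∈′ k = subst (InIdeal gens ∘ e (suc k)) (sym (∷ʳ-++ A i T)) (e∈ k)

    ẽ∈⇒Δ∈ : ∀ A T → (∀ k → InIdeal gens (ẽ (suc k) (A ++ T))) → ∀ d → InIdeal gens (Δ A T d)
    ẽ∈⇒Δ∈ A = go (reverseView A)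
      where
      go : ∀ {A} → Reverse A → ∀ T → (∀ k → InIdeal gens (ẽ (suc k) (A ++ T))) →
           ∀ d → InIdeal gens (Δ A T d)
      go {A} _ T _ zero = Δ-0∈ A T
      go [] T ẽ∈ (suc d) = InIdeal-scale gens (sign (suc (suc d))) (ẽ (suc d) T) (ẽ∈ d)
      go (A ∶ rA ∶ʳ i) T ẽ∈ (suc d) =
        InIdeal-resp gens (Δ (A ∷ʳ i) T (suc d)) (Δ A (i ∷ T) (suc d) +ₚ x i *ₚ Δ A (i ∷ T) d)
          (Δ-∷ʳ A i T d)
          (InIdeal-+ₚ gens (Δ A (i ∷ T) (suc d)) (x i *ₚ Δ A (i ∷ T) d)
            (go rA (i ∷ T) ẽ∈′ (suc d))
            (InIdeal-*ₚ gens (x i) (Δ A (i ∷ T) d) (go rA (i ∷ T) ẽ∈′ d)))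
        where
        ẽ∈′ : ∀ k → InIdeal gens (ẽ (suc k) (A ++ i ∷ T))
        ẽ∈′ k = subst (InIdeal gens ∘ ẽ (suc k)) (∷ʳ-++ A i T) (ẽ∈ k)

open Polynomials

-- opened only now: inside Polynomials, _+_ is addition in ℤ
open import Data.Nat using (_+_)

applyUpTo-cong : ∀ {A : Set} {f g : ℕ → A} → (∀ i → f i ≡ g i) →
                 ∀ k → applyUpTo f k ≡ applyUpTo g k
applyUpTo-cong f≗g zero = refl
applyUpTo-cong f≗g (suc k) = cong₂ _∷_ (f≗g 0) (applyUpTo-cong (f≗g ∘ suc) k)

applyUpTo-+ : ∀ {A : Set} (f : ℕ → A) m k →
              applyUpTo f (m + k) ≡ applyUpTo f m ++ applyUpTo (f ∘ (m +_)) k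
applyUpTo-+ f zero k = refl
applyUpTo-+ f (suc m) k = cong (f 0 ∷_) (applyUpTo-+ (f ∘ suc) m k)

interval-++ : ∀ {r n} → r ≤ n → interval 1 r ++ interval (suc r) n ≡ interval 1 n
interval-++ {r} {n} r≤n =
  trans (sym (applyUpTo-+ (1 +_) r (n ∸ r))) (cong (applyUpTo (1 +_)) (ℕ.m+[n∸m]≡n r≤n))

interval-∷ : ∀ {a b} → a ≤ b → interval a b ≡ a ∷ interval (suc a) b
interval-∷ {a} {b} a≤b rewrite ℕ.+-∸-assoc 1 a≤b =
  cong₂ _∷_ (ℕ.+-identityʳ a) (applyUpTo-cong (ℕ.+-suc a) (b ∸ a))

interval-empty : ∀ n → interval (suc n) n ≡ []
interval-empty n rewrite ℕ.n∸n≡0 n = refl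

e-above-length : ∀ {n} S k → length S ≤ k → e {n} (suc k) S ≡ 0ₚ
e-above-length [] k _ = refl
e-above-length {n} (i ∷ S) (suc k) (s≤s |S|≤k)
  rewrite e-above-length {n} S k |S|≤k | e-above-length {n} S (suc k) (ℕ.m≤n⇒m≤1+n |S|≤k) = refl

-- h_n = n, so the generators e_{h_n − s}(1, …, h_n) of I_h are the e_k(1, …, n), 0 < k ≤ n.
e∈Igens : ∀ {m} {h : Fin (suc m) → ℕ} → IsHessenberg (suc m) h → ∀ {k} → k < suc m →
          e (suc k) (interval 1 (suc m)) ∈ Igens h
e∈Igens {m} {h} H {k} k<n =
  subst (_∈ Igens h) generator≡
    (∈-concat⁺′ (∈-map⁺ (generator last) (∈-upTo⁺ s<n)) (∈-map⁺ generators (∈-allFin last)))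
  where
  open IsHessenberg H
  generator : Fin (suc m) → ℕ → Poly (suc m)
  generator i s = e (h i ∸ s) (interval 1 (h i))
  generators : Fin (suc m) → List (Poly (suc m))
  generators i = map (generator i) (upTo (suc (toℕ i)))
  last = fromℕ m
  hₙ≡n : h last ≡ suc m
  hₙ≡n = ℕ.≤-antisym (upper last) (subst (λ j → suc j ≤ h last) (toℕ-fromℕ m) (lower last))
  s = suc m ∸ suc k
  s<n : s < suc (toℕ last)
  s<n rewrite toℕ-fromℕ m = s≤s (ℕ.m∸n≤m m k)
  generator≡ : generator last s ≡ e (suc k) (interval 1 (suc m))
  generator≡ rewrite hₙ≡n | ℕ.m∸[m∸n]≡n k<n = refl

e∈Iₕ : ∀ {n} {h : Fin n → ℕ} → IsHessenberg n h → ∀ k → InIdeal (Igens h) (e (suc k) (interval 1 n))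
e∈Iₕ {zero} {h} _ k = InIdeal-0ₚ (Igens h)
e∈Iₕ {suc m} {h} H k with suc k ≤? suc m
... | yes k<n = InIdeal-gen (Igens h) (e∈Igens H k<n)
... | no k≮n =
  subst (InIdeal (Igens h)) (sym (e-above-length (interval 1 (suc m)) k |interval|≤k)) (InIdeal-0ₚ (Igens h))
  where
  |interval|≤k : length (interval 1 (suc m)) ≤ k
  |interval|≤k rewrite length-applyUpTo (1 +_) (suc m) = ℕ.≤-pred (ℕ.≰⇒> k≮n)

β-suc : ∀ {n} (h : Fin n → ℕ) i → β h (suc i) ≤ suc (β h i)
β-suc {n} h i =
  ℕ.≤-trans (ℕ.∸-monoʳ-≤ (suc i) count-mono) (ℕ.m≤n+o⇒m∸n≤o (suc i) (count i) suc-i≤)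
  where
  count : ℕ → ℕ
  count i = length (filter (λ k → h k <? i) (allFin n))
  count-mono : count i ≤ count (suc i)
  count-mono = length-mono-≤
    (filter⁺ (λ k → h k <? i) (λ k → h k <? suc i) (λ { refl → ℕ.m≤n⇒m≤1+n }) (⊆-refl {x = allFin n}))
  suc-i≤ : suc i ≤ count i + suc (i ∸ count i)
  suc-i≤ rewrite ℕ.+-suc (count i) (i ∸ count i) = s≤s (ℕ.m≤n+m∸n i (count i))

ẽ-∷-∈ : ∀ {n} (gens : List (Poly n)) {b i T} →
        InIdeal gens (ẽ b (i ∷ T)) → (∀ k → b < k → InIdeal gens (ẽ k T)) →
        ∀ k → b ≤ k → InIdeal gens (ẽ k (i ∷ T))
ẽ-∷-∈ gens {b} {i} {T} ẽ-b∈ tail∈ k b≤k = go (ℕ.≤⇒≤′ b≤k)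
  where
  go : ∀ {k} → b ≤′ k → InIdeal gens (ẽ k (i ∷ T))
  go ≤′-refl = ẽ-b∈
  go (≤′-step {k} b≤′k) =
    InIdeal-+ₚ gens (x i *ₚ ẽ k (i ∷ T)) (ẽ (suc k) T)
      (InIdeal-*ₚ gens (x i) (ẽ k (i ∷ T)) (go b≤′k)) (tail∈ (suc k) (s≤s (ℕ.≤′⇒≤ b≤′k)))

ẽβ∈Jgens : ∀ {n} (h : Fin n → ℕ) {i} → i < n → ẽ (β h (suc i)) (interval (suc i) n) ∈ Jgens h
ẽβ∈Jgens {n} h i<n = ∈-map⁺ (λ i → ẽ (β h i) (interval i n)) (∈-applyUpTo⁺ (1 +_) i<n)

-- Induction on the suffix (i+1, …, n), downwards from the empty suffix (t = 0):
-- β_{i+2} ≤ β_{i+1} + 1 makes the bound for the shorter suffix cover all degrees above β_{i+1}.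
ẽ∈Jₕ-suffix : ∀ {n} (h : Fin n → ℕ) t i → t + i ≡ n →
              ∀ k → β h (suc i) ≤ suc k → InIdeal (Jgens h) (ẽ (suc k) (interval (suc i) n))
ẽ∈Jₕ-suffix h zero i refl k _ =
  subst (InIdeal (Jgens h) ∘ ẽ (suc k)) (sym (interval-empty i)) (InIdeal-0ₚ (Jgens h))
ẽ∈Jₕ-suffix {n} h (suc t) i t+i≡n k β≤k =
  subst (InIdeal (Jgens h) ∘ ẽ (suc k)) (sym (interval-∷ i<n))
    (ẽ-∷-∈ (Jgens h) generator tail∈ (suc k) β≤k)
  where
  t+suc-i≡n : t + suc i ≡ n
  t+suc-i≡n = trans (ℕ.+-suc t i) t+i≡n
  i<n : i < n
  i<n = subst (i <_) t+suc-i≡n (ℕ.m≤n+m (suc i) t)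
  generator : InIdeal (Jgens h) (ẽ (β h (suc i)) (suc i ∷ interval (suc (suc i)) n))
  generator =
    subst (InIdeal (Jgens h) ∘ ẽ (β h (suc i))) (interval-∷ i<n) (InIdeal-gen (Jgens h) (ẽβ∈Jgens h i<n))
  tail∈ : ∀ k → β h (suc i) < k → InIdeal (Jgens h) (ẽ k (interval (suc (suc i)) n))
  tail∈ (suc k) β<k = ẽ∈Jₕ-suffix h t (suc i) t+suc-i≡n k (ℕ.≤-trans (β-suc h (suc i)) β<k)

ẽ∈Jₕ : ∀ {n} (h : Fin n → ℕ) k → InIdeal (Jgens h) (ẽ (suc k) (interval 1 n))
ẽ∈Jₕ {n} h k = ẽ∈Jₕ-suffix h n 0 (ℕ.+-identityʳ n) k β₁≤1+k
  where
  β₁≤1+k : β h 1 ≤ suc k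
  β₁≤1+k = ℕ.≤-trans (ℕ.m∸n≤m 1 (length (filter (λ k → h k <? 1) (allFin n)))) (s≤s z≤n)

corollary6p6 : (n : ℕ) (h : Fin n → ℕ) → IsHessenberg n h →
    (d r : ℕ) → 0 < d → d ≤ r → r ≤ n →
    (InIdeal (Igens h) (e d (interval 1 r)) ⇔ InIdeal (Igens h) (ẽ d (interval (r + 1) n)))
    × (InIdeal (Jgens h) (ẽ d (interval (r + 1) n)) ⇔ InIdeal (Jgens h) (e d (interval 1 r)))
corollary6p6 n h H d r _ _ r≤n rewrite ℕ.+-comm r 1 =
  Δ∈⇒[e∈⇔ẽ∈] (Igens h) A T d (e∈⇒Δ∈ (Igens h) A T e∈I d) ,
  ⇔-sym (Δ∈⇒[e∈⇔ẽ∈] (Jgens h) A T d (ẽ∈⇒Δ∈ (Jgens h) A T ẽ∈J d))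
  where
  A = interval 1 r
  T = interval (suc r) n
  A++T≡ : interval 1 n ≡ A ++ T
  A++T≡ = sym (interval-++ r≤n)
  e∈I : ∀ k → InIdeal (Igens h) (e (suc k) (A ++ T))
  e∈I k = subst (InIdeal (Igens h) ∘ e (suc k)) A++T≡ (e∈Iₕ H k)
  ẽ∈J : ∀ k → InIdeal (Jgens h) (ẽ (suc k) (A ++ T))
  ẽ∈J k = subst (InIdeal (Jgens h) ∘ ẽ (suc k)) A++T≡ (ẽ∈Jₕ h k)
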